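{- Let $\phi$ be a formula of the language $\Phi$. If $\vdash\phi$, then $w\Vdash\phi$ for every epistemic world $w\in W$ of every Kripke model with evidence $\langle W,E,\{\sim_e\}_{e\in E},\pi\rangle$.
   Context: Fix an infinite set of propositional variables. The set $\Phi$ of formulae is given by $\phi ::= p \mid \neg\phi \mid \phi\to\phi \mid \boxdot\phi \mid \Box\phi$, where $p$ ranges over propositional variables. The logical system consists of all propositional tautologies in the language $\Phi$ together with the axioms (for all formulae $\phi,\psi$): Truth $\Box\phi\to\phi$; Negative Introspection $\neg\Box\phi\to\Box\neg\Box\phi$; Distributivity $\Box(\phi\to\psi)\to(\Box\phi\to\Box\psi)$; Monotonicity $\boxdot\phi\to\Box\phi$; Attainable Positive Introspection $\boxdot\phi\to\boxdot\boxdot\phi$; Attainable Distributivity $\boxdot(\phi\to\psi)\to(\boxdot\phi\to\boxdot\psi)$. The inference rules are Modus Ponens (from $\phi$ and $\phi\to\psi$ infer $\psi$) and Attainable Necessitation (from $\phi$ infer $\boxdot\phi$). We write $\vdash\phi$ if $\phi$ is derivable from the axioms using these two rules. A Kripke model with evidence is a tuple $\langle W,E,\{\sim_e\}_{e\in E},\pi\rangle$ where $W$ is a set (of epistemic worlds), $E$ is an arbitrary set (of evidence), each $\sim_e$ is an equivalence relation on $W$, and $\pi$ maps propositional variables to subsets of $W$. For $F\subseteq E$ write $w\sim_F u$ if $w\sim_e u$ for all $e\in F$. Satisfaction is defined by: $w\Vdash p$ iff $w\in\pi(p)$; $w\Vdash\neg\phi$ iff $w\nVdash\phi$; $w\Vdash\phi\to\psi$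 iff $w\nVdash\phi$ or $w\Vdash\psi$; $w\Vdash\boxdot\phi$ iff there is a finite $F\subseteq E$ such that $u\Vdash\phi$ for every $u\in W$ with $w\sim_F u$; $w\Vdash\Box\phi$ iff $u\Vdash\phi$ for every $u\in W$ with $w\sim_E u$. -}

module Defs where

open import Level using (Level; _⊔_) renaming (suc to lsuc)
open import Data.Nat using (ℕ)
open import Data.Bool using (Bool; true; false; not; _∨_)
open import Data.List using (List)
open import Data.List.Relation.Unary.All using (All)
open import Data.Empty using (⊥)
open import Data.Sum using (_⊎_)
open import Data.Product using (Σ; ∃-syntax)
open import Relation.Binary.PropositionalEquality using (_≡_)
open import Relation.Binary.Structures using (IsEquivalence)

Var : Set
Var = ℕ

infixr 5 _⇒_
data Formula : Set where
  var  : Var → Formula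
  ¬'_  : Formula → Formula
  _⇒_  : Formula → Formula → Formula
  ⊡_   : Formula → Formula
  □_   : Formula → Formula

-- Propositional (Boolean) evaluation, treating variables and modal
-- formulas (□φ, ⊡φ) as atoms: v assigns a truth value to every formula,
-- but only its values at atoms matter.
evalB : (Formula → Bool) → Formula → Bool
evalB v (var p) = v (var p)
evalB v (¬' φ)  = not (evalB v φ)
evalB v (φ ⇒ ψ) = not (evalB v φ) ∨ evalB v ψ
evalB v (⊡ φ)   = v (⊡ φ)
evalB v (□ φ)   = v (□ φ)

Tautology : Formula → Set
Tautology φ = ∀ (v : Formula → Bool) → evalB v φ ≡ true

data ⊢_ : Formula → Set where
  taut   : ∀ {φ} → Tautology φ → ⊢ φ
  truth  : ∀ {φ} → ⊢ (□ φ ⇒ φ)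
  negInt : ∀ {φ} → ⊢ (¬' (□ φ) ⇒ □ (¬' (□ φ)))
  dist   : ∀ {φ ψ} → ⊢ (□ (φ ⇒ ψ) ⇒ (□ φ ⇒ □ ψ))
  mono   : ∀ {φ} → ⊢ (⊡ φ ⇒ □ φ)
  attPI  : ∀ {φ} → ⊢ (⊡ φ ⇒ ⊡ (⊡ φ))
  attD   : ∀ {φ ψ} → ⊢ (⊡ (φ ⇒ ψ) ⇒ (⊡ φ ⇒ ⊡ ψ))
  mp     : ∀ {φ ψ} → ⊢ φ → ⊢ (φ ⇒ ψ) → ⊢ ψ
  attNec : ∀ {φ} → ⊢ φ → ⊢ (⊡ φ)

record KripkeModel (a b c d : Level) : Set (lsuc (a ⊔ b ⊔ c ⊔ d)) where
  field
    W     : Set a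
    E     : Set b
    _∼[_]_ : W → E → W → Set c
    equiv : ∀ e → IsEquivalence (λ w u → w ∼[ e ] u)
    π     : Var → W → Set d

module _ {a b c d} (M : KripkeModel a b c d) where
  open KripkeModel M

  -- w ∼_F u for a finite set F ⊆ E (represented as a list).
  _∼F[_]_ : W → List E → W → Set (b ⊔ c)
  w ∼F[ F ] u = All (λ e → w ∼[ e ] u) F

  _∼E_ : W → W → Set (b ⊔ c)
  w ∼E u = ∀ (e : E) → w ∼[ e ] u

  _⊩_ : W → Formula → Set (a ⊔ b ⊔ c ⊔ d)
  w ⊩ var p   = Level.Lift (a ⊔ b ⊔ c) (π p w)
  w ⊩ (¬' φ)  = w ⊩ φ → ⊥
  w ⊩ (φ ⇒ ψ) = (w ⊩ φ → ⊥) ⊎ (w ⊩ ψ)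
  w ⊩ (⊡ φ)   = ∃[ F ] (∀ u → w ∼F[ F ] u → u ⊩ φ)
  w ⊩ (□ φ)   = ∀ u → w ∼E u → u ⊩ φ

module Submission where

open import Defs
open import Data.Bool using (Bool; true)
open import Data.Empty using (⊥-elim)
open import Data.Sum using (_⊎_; inj₁; inj₂)
open import Data.Product using (_,_)
open import Data.List using ([]; _++_)
import Data.List.Relation.Unary.All as All
open import Data.List.Relation.Unary.All.Properties using (++⁻ˡ; ++⁻ʳ)
open import Relation.Nullary using (¬_; Dec; yes; no; does; proof)
open import Relation.Nullary.Reflects using (Reflects; ofʸ; ¬-reflects; _⊎-reflects_)
open import Relation.Binary.PropositionalEquality using (_≡_; refl)
open import Relation.Binary.Structures using (IsEquivalence)

-- Implication is read as ¬φ ⊎ ψ,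
-- so excluded middle is what lets us introduce it.  For a tautology φ, evaluate
-- it at w under the valuation sending every formula to its own truth value at w:
-- evalB then reflects w ⊩ φ, because it only inspects atoms and the Boolean
-- connectives.  For ⊡, finitely many pieces of evidence are combined by
-- concatenating lists, and ⊡-necessitation holds with no evidence at all.

¬⊎⇒→ : ∀ {ℓ ℓ′} {A : Set ℓ} {B : Set ℓ′} → ¬ A ⊎ B → A → B
¬⊎⇒→ (inj₁ ¬a) a = ⊥-elim (¬a a)
¬⊎⇒→ (inj₂ b) _ = b

reflects-true : ∀ {ℓ} {A : Set ℓ} {x : Bool} → Reflects A x → x ≡ true → A
reflects-true (ofʸ a) refl = a

module Soundness (dec : ∀ {ℓ} (P : Set ℓ) → Dec P)
                 {a b c d} (M : KripkeModel a b c d) where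
  open KripkeModel M

  infix 4 _⊨_
  _⊨_ : W → Formula → Set _
  _⊨_ = _⊩_ M

  →⇒¬⊎ : ∀ {ℓ ℓ′} {A : Set ℓ} {B : Set ℓ′} → (A → B) → ¬ A ⊎ B
  →⇒¬⊎ {A = A} f with dec A
  ... | yes a = inj₂ (f a)
  ... | no ¬a = inj₁ ¬a

  ∼F-trans : ∀ {F u v w} → _∼F[_]_ M u F v → _∼F[_]_ M v F w → _∼F[_]_ M u F w
  ∼F-trans uv vw = All.zipWith (λ { (p , q) → IsEquivalence.trans (equiv _) p q }) (uv , vw)

  ∼E-refl : ∀ {u} → _∼E_ M u u
  ∼E-refl e = IsEquivalence.refl (equiv e)

  ∼E-euclidean : ∀ {u v w} → _∼E_ M u v → _∼E_ M u w → _∼E_ M v w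
  ∼E-euclidean uv uw e = IsEquivalence.trans (equiv e) (IsEquivalence.sym (equiv e) (uv e)) (uw e)

  ∼E⇒∼F : ∀ {F u v} → _∼E_ M u v → _∼F[_]_ M u F v
  ∼E⇒∼F uv = All.tabulate (λ {e} _ → uv e)

  truthAt : W → Formula → Bool
  truthAt w φ = does (dec (w ⊨ φ))

  evalB-truthAt-reflects : ∀ w φ → Reflects (w ⊨ φ) (evalB (truthAt w) φ)
  evalB-truthAt-reflects w (var p) = proof (dec (w ⊨ var p))
  evalB-truthAt-reflects w (⊡ φ)   = proof (dec (w ⊨ ⊡ φ))
  evalB-truthAt-reflects w (□ φ)   = proof (dec (w ⊨ □ φ))
  evalB-truthAt-reflects w (¬' φ)  = ¬-reflects (evalB-truthAt-reflects w φ)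
  evalB-truthAt-reflects w (φ ⇒ ψ) =
    ¬-reflects (evalB-truthAt-reflects w φ) ⊎-reflects evalB-truthAt-reflects w ψ

  tautology-valid : ∀ {φ} → Tautology φ → ∀ w → w ⊨ φ
  tautology-valid {φ} t w = reflects-true (evalB-truthAt-reflects w φ) (t (truthAt w))

  sound : ∀ {φ} → ⊢ φ → ∀ w → w ⊨ φ
  sound (taut t) w = tautology-valid t w
  sound truth  w = →⇒¬⊎ λ wφ → wφ w ∼E-refl
  sound negInt w = →⇒¬⊎ λ ¬w□φ u wu u□φ → ¬w□φ λ v wv → u□φ v (∼E-euclidean wu wv)
  sound dist   w = →⇒¬⊎ λ w□φ⇒ψ → →⇒¬⊎ λ w□φ u wu → ¬⊎⇒→ (w□φ⇒ψ u wu) (w□φ u wu)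
  sound mono   w = →⇒¬⊎ λ { (F , wφ) u wu → wφ u (∼E⇒∼F wu) }
  sound attPI  w = →⇒¬⊎ λ { (F , wφ) → F , λ u wu → F , λ v uv → wφ v (∼F-trans wu uv) }
  sound attD   w = →⇒¬⊎ λ { (F , wφ⇒ψ) → →⇒¬⊎ λ { (G , wφ) →
    F ++ G , λ u wu → ¬⊎⇒→ (wφ⇒ψ u (++⁻ˡ F wu)) (wφ u (++⁻ʳ F wu)) } }
  sound (mp ⊢φ ⊢φ⇒ψ) w = ¬⊎⇒→ (sound ⊢φ⇒ψ w) (sound ⊢φ w)
  sound (attNec ⊢φ)  w = [] , λ u _ → sound ⊢φ u

theorem1 : (∀ {ℓ} (P : Set ℓ) → Dec P) →
           ∀ {a b c d} (M : KripkeModel a b c d) (φ : Formula) → ⊢ φ →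
           ∀ (w : KripkeModel.W M) → _⊩_ M w φ
theorem1 dec M φ = Soundness.sound dec M
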